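{- Let $n\geq 4$ be an integer and $S(n)=\langle f_n^2,f_{n+1}^2,f_{n+2}^2\rangle$. (1) If $f_n$ is even (that is, $n=3k$ with $k\geq 2$), then \[\mathrm{PF}(S(n)) = \left\{ (f_{n+1}-1)f_{n+1}^2 + \left(\tfrac{f_n}{2}-1\right)f_{n+2}^2 - f_n^2,\ \left(\tfrac{f_{n+3}}{2}-1\right)f_{n+1}^2 + (f_{n-2}-1)f_{n+2}^2 - f_n^2 \right\}.\] (2) If $f_{n+1}$ is even (that is, $n=3k-1$ with $k\geq 2$), then \[\mathrm{PF}(S(n)) = \left\{ \left(\tfrac{f_{n+1}}{2}-1\right)f_{n+1}^2 + \left(\tfrac{f_{n+1}}{2}-1\right)f_{n+2}^2 - f_n^2,\ (f_{n+2}-1)f_{n+1}^2 + \left(\tfrac{f_{n-2}}{2}-1\right)f_{n+2}^2 - f_n^2 \right\}.\] (3) If $f_{n+2}$ is even (that is, $n=3k-2$ with $k\geq 2$), then \[\mathrm{PF}(S(n)) = \left\{ \left(\tfrac{f_{n-1}}{2}-1\right)f_{n+1}^2 + (f_n-1)f_{n+2}^2 - f_n^2,\ \left(\tfrac{f_{n+2}}{2}-1\right)f_{n+1}^2 + \left(\tfrac{f_{n-2}+f_n}{2}-1\right)f_{n+2}^2 - f_n^2 \right\}.\]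
   Context: The Fibonacci numbers are defined by $f_0=0$, $f_1=1$, $f_k=f_{k-1}+f_{k-2}$ for $k\geq 2$. $\langle a_1,a_2,a_3\rangle$ denotes the set of all non-negative integer linear combinations of $a_1,a_2,a_3$; for $n\geq4$ this is a numerical semigroup (a submonoid of $(\mathbb{N},+)$ with finite complement). For a numerical semigroup $S$, an integer $x$ is a pseudo-Frobenius number of $S$ if $x\in\mathbb{Z}\setminus S$ and $x+s\in S$ for all $s\in S\setminus\{0\}$; $\mathrm{PF}(S)$ denotes the set of pseudo-Frobenius numbers of $S$. -}

module Defs where

open import Data.Nat as ℕ using (ℕ; zero; suc)
open import Data.Integer using (ℤ; +_)
open import Data.Product using (∃-syntax; _×_)
open import Relation.Binary.PropositionalEquality using (_≡_)
open import Relation.Nullary using (¬_)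

fib : ℕ → ℕ
fib zero = 0
fib (suc zero) = 1
fib (suc (suc k)) = fib (suc k) ℕ.+ fib k

_∈⟨_,_,_⟩ : ℤ → ℕ → ℕ → ℕ → Set
x ∈⟨ a₁ , a₂ , a₃ ⟩ =
  ∃[ u ] ∃[ v ] ∃[ w ] x ≡ + (u ℕ.* a₁ ℕ.+ v ℕ.* a₂ ℕ.+ w ℕ.* a₃)

IsPF3 : ℕ → ℕ → ℕ → ℤ → Set
IsPF3 a₁ a₂ a₃ x =
  (¬ (x ∈⟨ a₁ , a₂ , a₃ ⟩)) ×
  (∀ (s : ℕ) → ¬ (s ≡ 0) → (+ s) ∈⟨ a₁ , a₂ , a₃ ⟩ →
     (x Data.Integer.+ + s) ∈⟨ a₁ , a₂ , a₃ ⟩)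

sq : ℕ → ℕ
sq m = m ℕ.* m

PF-S : ℕ → ℤ → Set
PF-S n = IsPF3 (sq (fib n)) (sq (fib (suc n))) (sq (fib (suc (suc n))))

F : ℕ → ℤ
F k = + fib k

F² : ℕ → ℤ
F² k = + sq (fib k)

-- (m / 2) as an integer (used only when m is even)
half : ℕ → ℤ
half m = + (m ℕ./ 2)

module Submission where

-- Write a = f_n², b = f_{n+1}², c = f_{n+2}².  In each parity class of n there are positive integers
-- r_ij, explicit linear forms in two neighbouring Fibonacci numbers, such that (a, b, c) is the cross
-- product of the rows (−r₂₁, c₂, −r₂₃) and (−r₃₁, −r₃₂, c₃), where c₂ = r₁₂ + r₃₂ and c₃ = r₁₃ + r₂₃;
-- so S(n) is a Herzog semigroup with relations c₂b = r₂₁a + r₂₃c, c₃c = r₃₁a + r₃₂b and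
-- (r₂₁ + r₃₁)a = r₁₂b + r₁₃c.  A pseudo-Frobenius number x has x + a ∈ S but x ∉ S, so x = αb + βc − a.
-- Such an element lies outside S exactly when (α, β) is in the box α < c₂, β < c₃, not both α ≥ r₁₂ and
-- β ≥ r₁₃: outside the box one of the relations rewrites it into S, and inside it a representation would
-- give an integral relation among a, b, c; since gcd(f_n², f_{n+1}²) = 1 that relation is an integral
-- combination of the two rows, and every sign pattern of the coefficients leaves the box.  So x is
-- pseudo-Frobenius iff (α, β) is a maximal point of the box: (r₁₂ − 1, c₃ − 1) or (c₂ − 1, r₁₃ − 1).

open import Defs
open import Data.Nat using (ℕ; _≤_; _∸_)
open import Data.Nat.Divisibility using (_∣_)
open import Data.Sum using (_⊎_)
open import Data.Product using (_×_)
open import Function.Bundles using (_⇔_)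
open import Relation.Binary.PropositionalEquality using (_≡_)

open import Data.Nat using (suc; zero; s≤s; NonZero)
import Data.Nat as ℕ
open import Data.Nat.Properties using (<-≤-trans; m≤m+n; +-comm)
open import Data.List using (_∷_; [])
open import Data.Product using (∃-syntax; _,_; proj₁; proj₂)
open import Data.Sum using (inj₁; inj₂)
open import Data.Empty using (⊥; ⊥-elim)
open import Relation.Binary.PropositionalEquality using (refl; sym; trans; cong; cong₂; subst; module ≡-Reasoning)

m+n≢0 : ∀ m n → .{{NonZero m}} → NonZero (m ℕ.+ n)
m+n≢0 m n = ℕ.>-nonZero (<-≤-trans (ℕ.>-nonZero⁻¹ m) (m≤m+n m n))

module Syzygies where

  open import Data.Integer using (ℤ; +_; -[1+_]; _+_; _-_; _*_; -_; 0ℤ; 1ℤ)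
  import Data.Integer as ℤ
  import Data.Integer.Properties as ℤ
  open import Data.Integer.Tactic.RingSolver using (solve)
  open ≡-Reasoning

  Bézout : ℤ → ℤ → Set
  Bézout A B = ∃[ P ] ∃[ Q ] P * A + Q * B ≡ 1ℤ

  ≡-via-zero : ∀ {L R e : ℤ} k → e ≡ 0ℤ → L - R ≡ k * e → L ≡ R
  ≡-via-zero {L} {R} k refl L-R≡k0 = ℤ.i-j≡0⇒i≡j L R (trans L-R≡k0 (ℤ.*-zeroʳ k))

  bézout-divides : ∀ {A B k x : ℤ} → Bézout A B → A * k ≡ B * x → ∃[ s ] A * s ≡ x
  bézout-divides {A} {B} {k} {x} (P , Q , bz) Ak≡Bx = P * x + Q * k , (begin
    A * (P * x + Q * k)     ≡⟨ solve (P ∷ Q ∷ A ∷ k ∷ x ∷ []) ⟩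
    P * A * x + Q * (A * k) ≡⟨ cong (λ z → P * A * x + Q * z) Ak≡Bx ⟩
    P * A * x + Q * (B * x) ≡⟨ solve (P ∷ Q ∷ A ∷ B ∷ x ∷ []) ⟩
    (P * A + Q * B) * x     ≡⟨ cong (_* x) bz ⟩
    1ℤ * x                  ≡⟨ ℤ.*-identityˡ x ⟩
    x                       ∎)

  cancel-combination : ∀ A {s t X Y c r i : ℤ} .{{_ : ℤ.NonZero A}} →
    A * s ≡ X → A * t ≡ Y → c * X - r * Y ≡ A * i → i ≡ s * c - t * r
  cancel-combination A {s} {t} {X} {Y} {c} {r} {i} As≡X At≡Y cX-rY≡Ai = ℤ.*-cancelˡ-≡ A i _ (begin
    A * i                       ≡⟨ sym cX-rY≡Ai ⟩
    c * X - r * Y               ≡⟨ cong₂ (λ p q → c * p - r * q) As≡X At≡Y ⟨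
    c * (A * s) - r * (A * t)   ≡⟨ solve (A ∷ s ∷ t ∷ c ∷ r ∷ []) ⟩
    A * (s * c - t * r)         ∎)

  -- (A, B, C) is the cross product of the rows (−r₂₁, c₂, −r₂₃) and (−r₃₁, −r₃₂, c₃): s and t are
  -- found by Cramer's rule, and they are integers because A is prime to B.
  syzygy : ∀ {A B C} c₂ c₃ r₂₁ r₂₃ r₃₁ r₃₂ →
    A ≡ c₂ * c₃ - r₂₃ * r₃₂ → B ≡ r₂₁ * c₃ + r₂₃ * r₃₁ → C ≡ r₃₁ * c₂ + r₃₂ * r₂₁ →
    .{{_ : ℤ.NonZero A}} → Bézout A B → ∀ U i j → U * A + i * B + j * C ≡ 0ℤ →
    ∃[ s ] ∃[ t ] i ≡ s * c₂ - t * r₃₂ × j ≡ t * c₃ - s * r₂₃ × U + (s * r₂₁ + t * r₃₁) ≡ 0ℤ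
  syzygy {A} {B} {C} c₂ c₃ r₂₁ r₂₃ r₃₁ r₃₂ A-minor B-minor C-minor bz U i j rel = solution
       (bézout-divides bz (≡-via-zero (- c₃) rel (eliminate-C-by-row₃ A-minor B-minor C-minor)))
       (bézout-divides bz (≡-via-zero (- r₂₃) rel (eliminate-C-by-row₂ A-minor B-minor C-minor)))
    where
    eliminate-C-by-row₃ : A ≡ c₂ * c₃ - r₂₃ * r₃₂ → B ≡ r₂₁ * c₃ + r₂₃ * r₃₁ → C ≡ r₃₁ * c₂ + r₃₂ * r₂₁ →
      A * - (c₃ * U + j * r₃₁) - B * (i * c₃ + j * r₃₂) ≡ - c₃ * (U * A + i * B + j * C)
    eliminate-C-by-row₃ refl refl refl = solve (c₂ ∷ c₃ ∷ r₂₁ ∷ r₂₃ ∷ r₃₁ ∷ r₃₂ ∷ U ∷ i ∷ j ∷ [])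
    eliminate-C-by-row₂ : A ≡ c₂ * c₃ - r₂₃ * r₃₂ → B ≡ r₂₁ * c₃ + r₂₃ * r₃₁ → C ≡ r₃₁ * c₂ + r₃₂ * r₂₁ →
      A * (j * r₂₁ - r₂₃ * U) - B * (i * r₂₃ + j * c₂) ≡ - r₂₃ * (U * A + i * B + j * C)
    eliminate-C-by-row₂ refl refl refl = solve (c₂ ∷ c₃ ∷ r₂₁ ∷ r₂₃ ∷ r₃₁ ∷ r₃₂ ∷ U ∷ i ∷ j ∷ [])
    adjugate₁ : A ≡ c₂ * c₃ - r₂₃ * r₃₂ → c₂ * (i * c₃ + j * r₃₂) - r₃₂ * (i * r₂₃ + j * c₂) ≡ A * i
    adjugate₁ refl = solve (c₂ ∷ c₃ ∷ r₂₃ ∷ r₃₂ ∷ i ∷ j ∷ [])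
    adjugate₂ : A ≡ c₂ * c₃ - r₂₃ * r₃₂ → c₃ * (i * r₂₃ + j * c₂) - r₂₃ * (i * c₃ + j * r₃₂) ≡ A * j
    adjugate₂ refl = solve (c₂ ∷ c₃ ∷ r₂₃ ∷ r₃₂ ∷ i ∷ j ∷ [])
    adjugate₃ : B ≡ r₂₁ * c₃ + r₂₃ * r₃₁ → C ≡ r₃₁ * c₂ + r₃₂ * r₂₁ →
      r₂₁ * (i * c₃ + j * r₃₂) + r₃₁ * (i * r₂₃ + j * c₂) ≡ i * B + j * C
    adjugate₃ refl refl = solve (c₂ ∷ c₃ ∷ r₂₁ ∷ r₂₃ ∷ r₃₁ ∷ r₃₂ ∷ i ∷ j ∷ [])
    solution : ∃[ s ] A * s ≡ i * c₃ + j * r₃₂ → ∃[ t ] A * t ≡ i * r₂₃ + j * c₂ →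
      ∃[ s ] ∃[ t ] i ≡ s * c₂ - t * r₃₂ × j ≡ t * c₃ - s * r₂₃ × U + (s * r₂₁ + t * r₃₁) ≡ 0ℤ
    solution (s , As) (t , At) =
      s , t , cancel-combination A As At (adjugate₁ A-minor) , cancel-combination A At As (adjugate₂ A-minor) ,
      ℤ.*-cancelˡ-≡ A _ 0ℤ (begin
        A * (U + (s * r₂₁ + t * r₃₁))
          ≡⟨ solve (A ∷ U ∷ s ∷ t ∷ r₂₁ ∷ r₃₁ ∷ []) ⟩
        U * A + (r₂₁ * (A * s) + r₃₁ * (A * t))
          ≡⟨ cong₂ (λ p q → U * A + (r₂₁ * p + r₃₁ * q)) As At ⟩
        U * A + (r₂₁ * (i * c₃ + j * r₃₂) + r₃₁ * (i * r₂₃ + j * c₂))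
          ≡⟨ cong (λ z → U * A + z) (adjugate₃ B-minor C-minor) ⟩
        U * A + (i * B + j * C)
          ≡⟨ ℤ.+-assoc (U * A) (i * B) (j * C) ⟨
        U * A + i * B + j * C
          ≡⟨ rel ⟩
        0ℤ
          ≡⟨ ℤ.*-zeroʳ A ⟨
        A * 0ℤ ∎)

  difference-cross : ∀ {M N P Q : ℤ} → M - N ≡ P - Q → M + Q ≡ P + N
  difference-cross {M} {N} {P} {Q} e = begin
    M + Q             ≡⟨ solve (M ∷ N ∷ Q ∷ []) ⟩
    (M - N) + (N + Q) ≡⟨ cong (_+ (N + Q)) e ⟩
    (P - Q) + (N + Q) ≡⟨ solve (P ∷ N ∷ Q ∷ []) ⟩
    P + N             ∎

  pos-difference-cross : ∀ {m n p q} → + m - + n ≡ + p - + q → m ℕ.+ q ≡ p ℕ.+ n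
  pos-difference-cross {m} {n} {p} {q} e = ℤ.+-injective (difference-cross {+ m} {+ n} {+ p} {+ q} e)

  relation-to-zero : ∀ {U A v B w C α β : ℤ} → α * B + β * C ≡ U * A + v * B + w * C →
    U * A + (v - α) * B + (w - β) * C ≡ 0ℤ
  relation-to-zero {U} {A} {v} {B} {w} {C} {α} {β} e = begin
    U * A + (v - α) * B + (w - β) * C           ≡⟨ solve (U ∷ A ∷ v ∷ B ∷ w ∷ C ∷ α ∷ β ∷ []) ⟩
    (U * A + v * B + w * C) - (α * B + β * C)   ≡⟨ cong (_- (α * B + β * C)) e ⟨
    (α * B + β * C) - (α * B + β * C)           ≡⟨ ℤ.+-inverseʳ (α * B + β * C) ⟩
    0ℤ                                          ∎

  pos-combination : ∀ α b β c → + (α ℕ.* b ℕ.+ β ℕ.* c) ≡ + α * + b + + β * + c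
  pos-combination α b β c = cong₂ _+_ (ℤ.pos-* α b) (ℤ.pos-* β c)

  pos-combination₃ : ∀ u a v b w c → + (u ℕ.* a ℕ.+ v ℕ.* b ℕ.+ w ℕ.* c) ≡ + u * + a + + v * + b + + w * + c
  pos-combination₃ u a v b w c = cong₂ _+_ (pos-combination u a v b) (ℤ.pos-* w c)

  one-negative : ∀ m n S C t R → + m - + n ≡ -[1+ S ] * + C - + t * + R → m ℕ.+ (suc S ℕ.* C ℕ.+ t ℕ.* R) ≡ n
  one-negative m n S C t R e = pos-difference-cross {m} {n} {0} (begin
    + m - + n                          ≡⟨ e ⟩
    -[1+ S ] * + C - + t * + R         ≡⟨ negate (+ suc S) (+ C) (+ t) (+ R) ⟩
    0ℤ - (+ suc S * + C + + t * + R)   ≡⟨ cong (λ z → 0ℤ - z) (pos-combination (suc S) C t R) ⟨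
    0ℤ - + (suc S ℕ.* C ℕ.+ t ℕ.* R)   ∎)
    where
    negate : ∀ X C T R → (- X) * C - T * R ≡ 0ℤ - (X * C + T * R)
    negate X C T R = solve (X ∷ C ∷ T ∷ R ∷ [])

  two-negative : ∀ m n S C T R → + m - + n ≡ -[1+ S ] * + C - -[1+ T ] * + R →
    m ℕ.+ suc S ℕ.* C ≡ suc T ℕ.* R ℕ.+ n
  two-negative m n S C T R e = pos-difference-cross {m} {n} (begin
    + m - + n                           ≡⟨ e ⟩
    -[1+ S ] * + C - -[1+ T ] * + R     ≡⟨ swap (+ suc S) (+ C) (+ suc T) (+ R) ⟩
    + suc T * + R - + suc S * + C       ≡⟨ cong₂ _-_ (ℤ.pos-* (suc T) R) (ℤ.pos-* (suc S) C) ⟨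
    + (suc T ℕ.* R) - + (suc S ℕ.* C)   ∎)
    where
    swap : ∀ X C Y R → (- X) * C - (- Y) * R ≡ Y * R - X * C
    swap X C Y R = solve (X ∷ C ∷ Y ∷ R ∷ [])

  minor-expansion : ∀ {a} r₁₂ r₁₃ r₂₃ r₃₂ → a ≡ r₁₂ ℕ.* r₁₃ ℕ.+ r₁₂ ℕ.* r₂₃ ℕ.+ r₃₂ ℕ.* r₁₃ →
    + a ≡ + (r₁₂ ℕ.+ r₃₂) * + (r₁₃ ℕ.+ r₂₃) - + r₂₃ * + r₃₂
  minor-expansion r₁₂ r₁₃ r₂₃ r₃₂ refl =
    trans (pos-combination₃ r₁₂ r₁₃ r₁₂ r₂₃ r₃₂ r₁₃) (expand (+ r₁₂) (+ r₁₃) (+ r₂₃) (+ r₃₂))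
    where
    expand : ∀ p q s r → p * q + p * s + r * q ≡ (p + r) * (q + s) - s * r
    expand p q s r = solve (p ∷ q ∷ s ∷ r ∷ [])

  -- By syzygy, (−(u + 1), v − α, w − β) = s (−r₂₁, c₂, −r₂₃) + t (−r₃₁, −r₃₂, c₃) with s and t not both
  -- nonnegative; the alternatives are the cases s < 0 ≤ t, t < 0 ≤ s and s, t < 0, with s = −1 − S, t = −1 − T.
  relation⇒row-combination : ∀ {a b c} c₂ c₃ r₂₁ r₂₃ r₃₁ r₃₂ →
    + a ≡ + c₂ * + c₃ - + r₂₃ * + r₃₂ → + b ≡ + r₂₁ * + c₃ + + r₂₃ * + r₃₁ → + c ≡ + r₃₁ * + c₂ + + r₃₂ * + r₂₁ →
    .{{_ : NonZero a}} → Bézout (+ a) (+ b) →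
    ∀ {α β u v w} → α ℕ.* b ℕ.+ β ℕ.* c ≡ suc u ℕ.* a ℕ.+ v ℕ.* b ℕ.+ w ℕ.* c →
    (∃[ S ] ∃[ t ] v ℕ.+ (suc S ℕ.* c₂ ℕ.+ t ℕ.* r₃₂) ≡ α)
    ⊎ (∃[ T ] ∃[ s ] w ℕ.+ (suc T ℕ.* c₃ ℕ.+ s ℕ.* r₂₃) ≡ β)
    ⊎ (∃[ S ] ∃[ T ] v ℕ.+ suc S ℕ.* c₂ ≡ suc T ℕ.* r₃₂ ℕ.+ α × w ℕ.+ suc T ℕ.* c₃ ≡ suc S ℕ.* r₂₃ ℕ.+ β)
  relation⇒row-combination {a} {b} {c} c₂ c₃ r₂₁ r₂₃ r₃₁ r₃₂ A-minor B-minor C-minor bz {α} {β} {u} {v} {w} e =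
    signs (syzygy (+ c₂) (+ c₃) (+ r₂₁) (+ r₂₃) (+ r₃₁) (+ r₃₂) A-minor B-minor C-minor bz
             (+ suc u) (+ v - + α) (+ w - + β)
             (relation-to-zero {+ suc u} {+ a} {+ v} {+ b} {+ w} {+ c} {+ α} {+ β} integral))
    where
    integral : + α * + b + + β * + c ≡ + suc u * + a + + v * + b + + w * + c
    integral = trans (sym (pos-combination α b β c)) (trans (cong +_ e) (pos-combination₃ (suc u) a v b w c))
    signs : ∃[ s ] ∃[ t ] + v - + α ≡ s * + c₂ - t * + r₃₂ × + w - + β ≡ t * + c₃ - s * + r₂₃ ×
              + suc u + (s * + r₂₁ + t * + r₃₁) ≡ 0ℤ →
      (∃[ S ] ∃[ t ] v ℕ.+ (suc S ℕ.* c₂ ℕ.+ t ℕ.* r₃₂) ≡ α)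
      ⊎ (∃[ T ] ∃[ s ] w ℕ.+ (suc T ℕ.* c₃ ℕ.+ s ℕ.* r₂₃) ≡ β)
      ⊎ (∃[ S ] ∃[ T ] v ℕ.+ suc S ℕ.* c₂ ≡ suc T ℕ.* r₃₂ ℕ.+ α × w ℕ.+ suc T ℕ.* c₃ ≡ suc S ℕ.* r₂₃ ℕ.+ β)
    signs (+ s , + t , _ , _ , U≡0) =
      ⊥-elim (positive (ℤ.+-injective (trans (cong (λ z → + suc u + z) (pos-combination s r₂₁ t r₃₁)) U≡0)))
      where
      positive : ∀ {n} → suc n ≡ 0 → ⊥
      positive ()
    signs (-[1+ S ] , + t , i≡ , _ , _) = inj₁ (S , t , one-negative v α S c₂ t r₃₂ i≡)
    signs (+ s , -[1+ T ] , _ , j≡ , _) = inj₂ (inj₁ (T , s , one-negative w β T c₃ s r₂₃ j≡))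
    signs (-[1+ S ] , -[1+ T ] , i≡ , j≡ , _) =
      inj₂ (inj₂ (S , T , two-negative v α S c₂ T r₃₂ i≡ , two-negative w β T c₃ S r₂₃ j≡))

module Coprimality where

  open import Data.Integer using (ℤ; +_; _+_; _-_; _*_; 1ℤ)
  import Data.Integer.Properties as ℤ
  open import Data.Integer.Tactic.RingSolver using (solve)
  open Syzygies using (Bézout)
  open ≡-Reasoning

  -- The witnesses come from expanding (P m + Q n)³ = 1.
  bézout-sq : ∀ {m n} → Bézout (+ m) (+ n) → Bézout (+ sq m) (+ sq n)
  bézout-sq {m} {n} (P , Q , bz) = P * P * P * M + + 3 * P * P * Q * N , + 3 * P * Q * Q * M + Q * Q * Q * N , (begin
    (P * P * P * M + + 3 * P * P * Q * N) * + sq m + (+ 3 * P * Q * Q * M + Q * Q * Q * N) * + sq n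
      ≡⟨ cong₂ (λ s t → (P * P * P * M + + 3 * P * P * Q * N) * s + (+ 3 * P * Q * Q * M + Q * Q * Q * N) * t)
               (ℤ.pos-* m m) (ℤ.pos-* n n) ⟩
    (P * P * P * M + + 3 * P * P * Q * N) * (M * M) + (+ 3 * P * Q * Q * M + Q * Q * Q * N) * (N * N)
      ≡⟨ cube P Q M N ⟩
    (P * M + Q * N) * (P * M + Q * N) * (P * M + Q * N)
      ≡⟨ cong (λ z → z * z * z) bz ⟩
    1ℤ ∎)
    where
    M = + m
    N = + n
    cube : ∀ P Q M N → (P * P * P * M + + 3 * P * P * Q * N) * (M * M) + (+ 3 * P * Q * Q * M + Q * Q * Q * N) * (N * N)
                       ≡ (P * M + Q * N) * (P * M + Q * N) * (P * M + Q * N)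
    cube P Q M N = solve (P ∷ Q ∷ M ∷ N ∷ [])

  fib-bézout : ∀ n → Bézout (+ fib n) (+ fib (suc n))
  fib-bézout zero = + 0 , + 1 , refl
  fib-bézout (suc n) with fib-bézout n
  ... | P , Q , bz = Q - P , P , trans (step P Q (+ fib n) (+ fib (suc n))) bz
    where
    step : ∀ P Q X Y → (Q - P) * Y + P * (Y + X) ≡ P * X + Q * Y
    step P Q X Y = solve (P ∷ Q ∷ X ∷ Y ∷ [])

module Gaps where

  open import Data.Integer using (ℤ; +_; _+_; _-_; _*_)
  import Data.Integer.Properties as ℤ
  open import Data.Integer.Tactic.RingSolver using (solve)
  import Data.Nat.Tactic.RingSolver as ℕ-Solver
  open import Function.Bundles using (mk⇔)
  open import Relation.Nullary using (¬_)
  open Syzygies using (pos-combination)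
  open ≡-Reasoning

  gap : ℕ → ℕ → ℕ → ℕ → ℕ → ℤ
  gap a b c α β = (+ α - + 1) * + b + (+ β - + 1) * + c - + a

  -- A record rather than a definition, so that its indices are recovered by unification.
  record PF≡gaps (a b c α₁ β₁ α₂ β₂ : ℕ) : Set where
    constructor pf≡gaps
    field
      characterisation : ∀ x → IsPF3 a b c x ⇔ (x ≡ gap a b c α₁ β₁ ⊎ x ≡ gap a b c α₂ β₂)

  PF≡gaps-cong : ∀ {a b c α₁ β₁ α₂ β₂} → PF≡gaps a b c α₁ β₁ α₂ β₂ → ∀ {α₁′ β₁′ α₂′ β₂′} →
    α₁ ≡ α₁′ → β₁ ≡ β₁′ → α₂ ≡ α₂′ → β₂ ≡ β₂′ → PF≡gaps a b c α₁′ β₁′ α₂′ β₂′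
  PF≡gaps-cong pf refl refl refl refl = pf

  _∈₊⟨_,_,_⟩ : ℕ → ℕ → ℕ → ℕ → Set
  n ∈₊⟨ a , b , c ⟩ = ∃[ u ] ∃[ v ] ∃[ w ] n ≡ suc u ℕ.* a ℕ.+ v ℕ.* b ℕ.+ w ℕ.* c

  private
    move-right : ∀ {i j k : ℤ} → i - j ≡ k → i ≡ k + j
    move-right {i} {j} refl = solve (i ∷ j ∷ [])

    move-left : ∀ {i j k : ℤ} → i ≡ k + j → i - j ≡ k
    move-left {j = j} {k} refl = solve (j ∷ k ∷ [])

    suc-combination : ∀ u a v b w c → + (suc u ℕ.* a ℕ.+ v ℕ.* b ℕ.+ w ℕ.* c) ≡ + (u ℕ.* a ℕ.+ v ℕ.* b ℕ.+ w ℕ.* c) + + a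
    suc-combination u a v b w c = cong +_ (ℕ-Solver.solve (u ∷ a ∷ v ∷ b ∷ w ∷ c ∷ []))

  gap-∈⇔ : ∀ {a b c} α β → gap a b c (suc α) (suc β) ∈⟨ a , b , c ⟩ ⇔ (α ℕ.* b ℕ.+ β ℕ.* c) ∈₊⟨ a , b , c ⟩
  gap-∈⇔ {a} {b} {c} α β = mk⇔
    (λ (u , v , w , e) → u , v , w , ℤ.+-injective (begin
      + (α ℕ.* b ℕ.+ β ℕ.* c)                     ≡⟨ pos-combination α b β c ⟩
      + α * + b + + β * + c                       ≡⟨ move-right e ⟩
      + (u ℕ.* a ℕ.+ v ℕ.* b ℕ.+ w ℕ.* c) + + a   ≡⟨ suc-combination u a v b w c ⟨
      + (suc u ℕ.* a ℕ.+ v ℕ.* b ℕ.+ w ℕ.* c)     ∎))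
    (λ (u , v , w , e) → u , v , w , move-left (begin
      + α * + b + + β * + c                       ≡⟨ pos-combination α b β c ⟨
      + (α ℕ.* b ℕ.+ β ℕ.* c)                     ≡⟨ cong +_ e ⟩
      + (suc u ℕ.* a ℕ.+ v ℕ.* b ℕ.+ w ℕ.* c)     ≡⟨ suc-combination u a v b w c ⟩
      + (u ℕ.* a ℕ.+ v ℕ.* b ℕ.+ w ℕ.* c) + + a   ∎))

  gap-+ᵃ : ∀ a b c α β → gap a b c (suc α) (suc β) + + a ≡ + (α ℕ.* b ℕ.+ β ℕ.* c)
  gap-+ᵃ a b c α β = trans (add-back (+ α * + b + + β * + c) (+ a)) (sym (pos-combination α b β c))
    where
    add-back : ∀ y a → y - a + a ≡ y
    add-back y a = solve (y ∷ a ∷ [])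

  gap-+ᵇ : ∀ a b c α β → gap a b c (suc α) (suc β) + + b ≡ gap a b c (suc (suc α)) (suc β)
  gap-+ᵇ a b c α β = shift (+ α) (+ b) (+ β) (+ c) (+ a)
    where
    shift : ∀ α b β c a → α * b + β * c - a + b ≡ (+ 1 + α) * b + β * c - a
    shift α b β c a = solve (α ∷ b ∷ β ∷ c ∷ a ∷ [])

  gap-+ᶜ : ∀ a b c α β → gap a b c (suc α) (suc β) + + c ≡ gap a b c (suc α) (suc (suc β))
  gap-+ᶜ a b c α β = shift (+ α) (+ b) (+ β) (+ c) (+ a)
    where
    shift : ∀ α b β c a → α * b + β * c - a + c ≡ α * b + (+ 1 + β) * c - a
    shift α b β c a = solve (α ∷ b ∷ β ∷ c ∷ a ∷ [])

  ∈-+ : ∀ {a b c x n} → x ∈⟨ a , b , c ⟩ → (+ n) ∈⟨ a , b , c ⟩ → (x + + n) ∈⟨ a , b , c ⟩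
  ∈-+ {a} {b} {c} (u , v , w , refl) (u′ , v′ , w′ , refl) = u ℕ.+ u′ , v ℕ.+ v′ , w ℕ.+ w′ ,
    cong +_ (ℕ-Solver.solve (u ∷ v ∷ w ∷ u′ ∷ v′ ∷ w′ ∷ a ∷ b ∷ c ∷ []))

  private
    cancel-right : ∀ {x y k : ℤ} → x + k ≡ y + k → x ≡ y
    cancel-right {x} {y} {k} e = begin
      x           ≡⟨ solve (x ∷ k ∷ []) ⟩
      x + k - k   ≡⟨ cong (_- k) e ⟩
      y + k - k   ≡⟨ solve (y ∷ k ∷ []) ⟩
      y           ∎

    subtract : ∀ {x j i : ℤ} → x + j ≡ i → x ≡ i - j
    subtract {x} {j} refl = solve (x ∷ j ∷ [])

  gap-or-∈ : ∀ {a b c x} → (x + + a) ∈⟨ a , b , c ⟩ → x ∈⟨ a , b , c ⟩ ⊎ ∃[ α ] ∃[ β ] x ≡ gap a b c (suc α) (suc β)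
  gap-or-∈ {a} {b} {c} (suc u , v , w , e) = inj₁ (u , v , w , cancel-right (trans e (suc-combination u a v b w c)))
  gap-or-∈ {a} {b} {c} (zero , v , w , e) = inj₂ (v , w , trans (subtract e) (cong (_- + a) (pos-combination v b w c)))

  generators-∈ : ∀ a b c → (+ a) ∈⟨ a , b , c ⟩ × (+ b) ∈⟨ a , b , c ⟩ × (+ c) ∈⟨ a , b , c ⟩
  generators-∈ a b c =
    (1 , 0 , 0 , cong +_ (ℕ-Solver.solve (a ∷ b ∷ c ∷ []))) ,
    (0 , 1 , 0 , cong +_ (ℕ-Solver.solve (a ∷ b ∷ c ∷ []))) ,
    (0 , 0 , 1 , cong +_ (ℕ-Solver.solve (a ∷ b ∷ c ∷ [])))

  private
    peel-a : ∀ u v w a b c → suc u ℕ.* a ℕ.+ v ℕ.* b ℕ.+ w ℕ.* c ≡ a ℕ.+ (u ℕ.* a ℕ.+ v ℕ.* b ℕ.+ w ℕ.* c)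
    peel-a u v w a b c = ℕ-Solver.solve (u ∷ v ∷ w ∷ a ∷ b ∷ c ∷ [])

    peel-b : ∀ v w a b c → 0 ℕ.* a ℕ.+ suc v ℕ.* b ℕ.+ w ℕ.* c ≡ b ℕ.+ (0 ℕ.* a ℕ.+ v ℕ.* b ℕ.+ w ℕ.* c)
    peel-b v w a b c = ℕ-Solver.solve (v ∷ w ∷ a ∷ b ∷ c ∷ [])

    peel-c : ∀ w a b c → 0 ℕ.* a ℕ.+ 0 ℕ.* b ℕ.+ suc w ℕ.* c ≡ c ℕ.+ (0 ℕ.* a ℕ.+ 0 ℕ.* b ℕ.+ w ℕ.* c)
    peel-c w a b c = ℕ-Solver.solve (w ∷ a ∷ b ∷ c ∷ [])

  PF-by-generators : ∀ {a b c x} → ¬ x ∈⟨ a , b , c ⟩ →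
    (x + + a) ∈⟨ a , b , c ⟩ → (x + + b) ∈⟨ a , b , c ⟩ → (x + + c) ∈⟨ a , b , c ⟩ → IsPF3 a b c x
  PF-by-generators {a} {b} {c} {x} x∉ x+a∈ x+b∈ x+c∈ = x∉ , closed
    where
    through : ∀ {g s t} → (x + + g) ∈⟨ a , b , c ⟩ → (+ s) ≡ + (g ℕ.+ t) → (+ t) ∈⟨ a , b , c ⟩ → (x + + s) ∈⟨ a , b , c ⟩
    through {g} {t = t} x+g∈ refl t∈ rewrite sym (ℤ.+-assoc x (+ g) (+ t)) = ∈-+ x+g∈ t∈
    closed : ∀ s → ¬ s ≡ 0 → (+ s) ∈⟨ a , b , c ⟩ → (x + + s) ∈⟨ a , b , c ⟩
    closed s _ (suc u , v , w , e) = through x+a∈ (trans e (cong +_ (peel-a u v w a b c))) (u , v , w , refl)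
    closed s _ (zero , suc v , w , e) = through x+b∈ (trans e (cong +_ (peel-b v w a b c))) (0 , v , w , refl)
    closed s _ (zero , zero , suc w , e) = through x+c∈ (trans e (cong +_ (peel-c w a b c))) (0 , 0 , w , refl)
    closed s s≢0 (zero , zero , zero , e) = ⊥-elim (s≢0 (ℤ.+-injective e))

  PF⇒generators-∈ : ∀ {a b c x} → .{{NonZero a}} → .{{NonZero b}} → .{{NonZero c}} → IsPF3 a b c x →
    (x + + a) ∈⟨ a , b , c ⟩ × (x + + b) ∈⟨ a , b , c ⟩ × (x + + c) ∈⟨ a , b , c ⟩
  PF⇒generators-∈ {a} {b} {c} (_ , closed) with generators-∈ a b c
  ... | a∈ , b∈ , c∈ = closed a (ℕ.≢-nonZero⁻¹ a) a∈ , closed b (ℕ.≢-nonZero⁻¹ b) b∈ , closed c (ℕ.≢-nonZero⁻¹ c) c∈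

module HerzogArithmetic where

  open import Data.Nat using (_+_; _*_; _<_; pred)
  import Data.Nat.Properties as ℕ
  open import Data.Nat.Tactic.RingSolver using (solve)
  open import Relation.Nullary using (¬_; yes; no)

  relations : ∀ {a b c} r₁₂ r₁₃ r₂₁ r₂₃ r₃₁ r₃₂ →
    a ≡ r₁₂ * r₁₃ + r₁₂ * r₂₃ + r₃₂ * r₁₃ → b ≡ r₂₁ * (r₁₃ + r₂₃) + r₂₃ * r₃₁ → c ≡ r₃₁ * (r₁₂ + r₃₂) + r₃₂ * r₂₁ →
    (r₂₁ + r₃₁) * a ≡ r₁₂ * b + r₁₃ * c × (r₁₂ + r₃₂) * b ≡ r₂₁ * a + r₂₃ * c × (r₁₃ + r₂₃) * c ≡ r₃₁ * a + r₃₂ * b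
  relations r₁₂ r₁₃ r₂₁ r₂₃ r₃₁ r₃₂ refl refl refl =
    solve (r₁₂ ∷ r₁₃ ∷ r₂₁ ∷ r₂₃ ∷ r₃₁ ∷ r₃₂ ∷ []) ,
    solve (r₁₂ ∷ r₁₃ ∷ r₂₁ ∷ r₂₃ ∷ r₃₁ ∷ r₃₂ ∷ []) ,
    solve (r₁₂ ∷ r₁₃ ∷ r₂₁ ∷ r₂₃ ∷ r₃₁ ∷ r₃₂ ∷ [])

  shift-b : ∀ {a b c} p r s k β → p * b ≡ r * a + s * c → (p + k) * b + β * c ≡ r * a + k * b + (β + s) * c
  shift-b {a} {b} {c} p r s k β pb≡ = begin
    (p + k) * b + β * c               ≡⟨ solve (p ∷ k ∷ b ∷ β ∷ c ∷ []) ⟩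
    p * b + (k * b + β * c)           ≡⟨ cong (_+ (k * b + β * c)) pb≡ ⟩
    r * a + s * c + (k * b + β * c)   ≡⟨ solve (r ∷ a ∷ s ∷ c ∷ k ∷ b ∷ β ∷ []) ⟩
    r * a + k * b + (β + s) * c       ∎
    where open ≡-Reasoning

  shift-c : ∀ {a b c} p r s α k → p * c ≡ r * a + s * b → α * b + (p + k) * c ≡ r * a + (α + s) * b + k * c
  shift-c {a} {b} {c} p r s α k pc≡ = begin
    α * b + (p + k) * c               ≡⟨ solve (α ∷ b ∷ p ∷ k ∷ c ∷ []) ⟩
    p * c + (α * b + k * c)           ≡⟨ cong (_+ (α * b + k * c)) pc≡ ⟩
    r * a + s * b + (α * b + k * c)   ≡⟨ solve (r ∷ a ∷ s ∷ b ∷ α ∷ k ∷ c ∷ []) ⟩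
    r * a + (α + s) * b + k * c       ∎
    where open ≡-Reasoning

  shift-bc : ∀ {a b c} p q r k l → r * a ≡ p * b + q * c → (p + k) * b + (q + l) * c ≡ r * a + k * b + l * c
  shift-bc {a} {b} {c} p q r k l ra≡ = begin
    (p + k) * b + (q + l) * c         ≡⟨ solve (p ∷ k ∷ b ∷ q ∷ l ∷ c ∷ []) ⟩
    (p * b + q * c) + (k * b + l * c) ≡⟨ cong (_+ (k * b + l * c)) ra≡ ⟨
    r * a + (k * b + l * c)           ≡⟨ solve (r ∷ a ∷ k ∷ b ∷ l ∷ c ∷ []) ⟩
    r * a + k * b + l * c             ∎
    where open ≡-Reasoning

  -- Excludes the case s, t < 0 of relation⇒row-combination.
  crossing : ∀ {α β v w S T p q r s} → α < p → β < r + s →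
    v + suc S * (p + q) ≡ suc T * q + α → w + suc T * (r + s) ≡ suc S * s + β → ⊥
  crossing {α} {β} {v} {w} {S} {T} {p} {q} {r} {s} α<p β<r+s v≡ w≡ with T ℕ.≤? S
  ... | yes T≤S = ℕ.<-irrefl refl (begin-strict
    p + suc S * q           ≤⟨ ℕ.+-monoˡ-≤ (suc S * q) (ℕ.m≤n*m p (suc S)) ⟩
    suc S * p + suc S * q   ≡⟨ ℕ.*-distribˡ-+ (suc S) p q ⟨
    suc S * (p + q)         ≤⟨ ℕ.m≤n+m _ v ⟩
    v + suc S * (p + q)     ≡⟨ v≡ ⟩
    suc T * q + α           ≤⟨ ℕ.+-monoˡ-≤ α (ℕ.*-monoˡ-≤ q (s≤s T≤S)) ⟩
    suc S * q + α           <⟨ ℕ.+-monoʳ-< (suc S * q) α<p ⟩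
    suc S * q + p           ≡⟨ ℕ.+-comm (suc S * q) p ⟩
    p + suc S * q           ∎)
    where open ℕ.≤-Reasoning
  ... | no T≰S = ℕ.<-irrefl refl (begin-strict
    (r + s) + suc S * s             ≤⟨ ℕ.+-monoʳ-≤ (r + s) (ℕ.*-monoʳ-≤ (suc S) (ℕ.m≤n+m s r)) ⟩
    suc (suc S) * (r + s)           ≤⟨ ℕ.*-monoˡ-≤ (r + s) (s≤s (ℕ.≰⇒> T≰S)) ⟩
    suc T * (r + s)                 ≤⟨ ℕ.m≤n+m _ w ⟩
    w + suc T * (r + s)             ≡⟨ w≡ ⟩
    suc S * s + β                   <⟨ ℕ.+-monoʳ-< (suc S * s) β<r+s ⟩
    suc S * s + (r + s)             ≡⟨ ℕ.+-comm (suc S * s) (r + s) ⟩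
    (r + s) + suc S * s             ∎)
    where open ℕ.≤-Reasoning

  last-below : ∀ {m n} → m < n → ¬ suc m < n → suc m ≡ n
  last-below m<n 1+m≮n = ℕ.≤-antisym m<n (ℕ.≮⇒≥ 1+m≮n)

  pred< : ∀ n → .{{NonZero n}} → pred n < n
  pred< n = ℕ.≤-reflexive (ℕ.suc-pred n)

  ≤suc-pred : ∀ n → .{{NonZero n}} → n ≤ suc (pred n)
  ≤suc-pred n = ℕ.≤-reflexive (sym (ℕ.suc-pred n))

-- a-minor is a = c₂ c₃ − r₂₃ r₃₂ expanded, to avoid truncated subtraction.
module Herzog
  (a b c r₁₂ r₁₃ r₂₁ r₂₃ r₃₁ r₃₂ : ℕ)
  .{{_ : NonZero r₁₂}} .{{_ : NonZero r₁₃}} .{{_ : NonZero r₂₁}}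
  .{{_ : NonZero r₂₃}} .{{_ : NonZero r₃₁}} .{{_ : NonZero r₃₂}}
  (a-minor : a ≡ r₁₂ ℕ.* r₁₃ ℕ.+ r₁₂ ℕ.* r₂₃ ℕ.+ r₃₂ ℕ.* r₁₃)
  (b-minor : b ≡ r₂₁ ℕ.* (r₁₃ ℕ.+ r₂₃) ℕ.+ r₂₃ ℕ.* r₃₁)
  (c-minor : c ≡ r₃₁ ℕ.* (r₁₂ ℕ.+ r₃₂) ℕ.+ r₃₂ ℕ.* r₂₁)
  where

  open import Data.Nat using (_+_; _*_; _<_; _≤?_; _<?_; pred)
  import Data.Nat.Properties as ℕ
  open import Data.Integer using (+_)
  import Data.Integer as ℤ
  open import Function.Bundles using (mk⇔; Equivalence)
  open import Relation.Nullary using (¬_; yes; no)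
  open Syzygies using (Bézout; relation⇒row-combination; minor-expansion; pos-combination)
  open Gaps
  open HerzogArithmetic

  c₂ c₃ : ℕ
  c₂ = r₁₂ + r₃₂
  c₃ = r₁₃ + r₂₃

  private
    rows : (r₂₁ + r₃₁) * a ≡ r₁₂ * b + r₁₃ * c × c₂ * b ≡ r₂₁ * a + r₂₃ * c × c₃ * c ≡ r₃₁ * a + r₃₂ * b
    rows = relations r₁₂ r₁₃ r₂₁ r₂₃ r₃₁ r₃₂ a-minor b-minor c-minor

    row₁ : (r₂₁ + r₃₁) * a ≡ r₁₂ * b + r₁₃ * c
    row₁ = proj₁ rows

    row₂ : c₂ * b ≡ r₂₁ * a + r₂₃ * c
    row₂ = proj₁ (proj₂ rows)

    row₃ : c₃ * c ≡ r₃₁ * a + r₃₂ * b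
    row₃ = proj₂ (proj₂ rows)

    instance
      c₂-nonZero : NonZero c₂
      c₂-nonZero = m+n≢0 r₁₂ r₃₂
      c₃-nonZero : NonZero c₃
      c₃-nonZero = m+n≢0 r₁₃ r₂₃
      a-nonZero : NonZero a
      a-nonZero rewrite a-minor = m+n≢0 (r₁₂ * r₁₃ + r₁₂ * r₂₃) (r₃₂ * r₁₃) {{m+n≢0 (r₁₂ * r₁₃) _ {{ℕ.m*n≢0 r₁₂ r₁₃}}}}
      b-nonZero : NonZero b
      b-nonZero rewrite b-minor = m+n≢0 (r₂₁ * c₃) (r₂₃ * r₃₁) {{ℕ.m*n≢0 r₂₁ c₃}}
      c-nonZero : NonZero c
      c-nonZero rewrite c-minor = m+n≢0 (r₃₁ * c₂) (r₃₂ * r₂₁) {{ℕ.m*n≢0 r₃₁ c₂}}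

  -- The elements α b + β c with (α, β) in the box form the Apéry set of a.
  InBox : ℕ → ℕ → Set
  InBox α β = α < c₂ × β < c₃ × ¬ (r₁₂ ≤ α × r₁₃ ≤ β)

  beyond-c₂ : ∀ {α} β → c₂ ≤ α → (α * b + β * c) ∈₊⟨ a , b , c ⟩
  beyond-c₂ β c₂≤α with ℕ.m≤n⇒∃[o]m+o≡n c₂≤α
  ... | k , refl = pred r₂₁ , k , β + r₂₃ ,
    trans (shift-b c₂ r₂₁ r₂₃ k β row₂)
          (cong (λ r → r * a + k * b + (β + r₂₃) * c) (sym (ℕ.suc-pred r₂₁)))

  beyond-c₃ : ∀ α {β} → c₃ ≤ β → (α * b + β * c) ∈₊⟨ a , b , c ⟩
  beyond-c₃ α c₃≤β with ℕ.m≤n⇒∃[o]m+o≡n c₃≤β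
  ... | k , refl = pred r₃₁ , α + r₃₂ , k ,
    trans (shift-c c₃ r₃₁ r₃₂ α k row₃)
          (cong (λ r → r * a + (α + r₃₂) * b + k * c) (sym (ℕ.suc-pred r₃₁)))

  in-corner : ∀ {α β} → r₁₂ ≤ α → r₁₃ ≤ β → (α * b + β * c) ∈₊⟨ a , b , c ⟩
  in-corner r₁₂≤α r₁₃≤β with ℕ.m≤n⇒∃[o]m+o≡n r₁₂≤α | ℕ.m≤n⇒∃[o]m+o≡n r₁₃≤β
  ... | k , refl | l , refl = pred r₂₁ + r₃₁ , k , l ,
    trans (shift-bc r₁₂ r₁₃ (r₂₁ + r₃₁) k l row₁)
          (cong (λ r → (r + r₃₁) * a + k * b + l * c) (sym (ℕ.suc-pred r₂₁)))

  ∉⇒InBox : ∀ {α β} → ¬ (α * b + β * c) ∈₊⟨ a , b , c ⟩ → InBox α β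
  ∉⇒InBox {α} {β} ∉ = α<c₂ , β<c₃ , λ (r₁₂≤α , r₁₃≤β) → ∉ (in-corner r₁₂≤α r₁₃≤β)
    where
    α<c₂ : α < c₂
    α<c₂ with α <? c₂
    ... | yes α<c₂ = α<c₂
    ... | no α≮c₂ = ⊥-elim (∉ (beyond-c₂ β (ℕ.≮⇒≥ α≮c₂)))
    β<c₃ : β < c₃
    β<c₃ with β <? c₃
    ... | yes β<c₃ = β<c₃
    ... | no β≮c₃ = ⊥-elim (∉ (beyond-c₃ α (ℕ.≮⇒≥ β≮c₃)))

  InBox⇒∉ : Bézout (+ a) (+ b) → ∀ {α β} → InBox α β → ¬ (α * b + β * c) ∈₊⟨ a , b , c ⟩
  InBox⇒∉ bz {α} {β} (α<c₂ , β<c₃ , ¬corner) (u , v , w , e) = impossible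
    (relation⇒row-combination {a} {b} {c} c₂ c₃ r₂₁ r₂₃ r₃₁ r₃₂ (minor-expansion r₁₂ r₁₃ r₂₃ r₃₂ a-minor)
       (trans (cong +_ b-minor) (pos-combination r₂₁ c₃ r₂₃ r₃₁))
       (trans (cong +_ c-minor) (pos-combination r₃₁ c₂ r₃₂ r₂₁)) bz {α} {β} {u} {v} {w} e)
    where
    impossible : (∃[ S ] ∃[ t ] v + (suc S * c₂ + t * r₃₂) ≡ α)
      ⊎ (∃[ T ] ∃[ s ] w + (suc T * c₃ + s * r₂₃) ≡ β)
      ⊎ (∃[ S ] ∃[ T ] v + suc S * c₂ ≡ suc T * r₃₂ + α × w + suc T * c₃ ≡ suc S * r₂₃ + β) → ⊥
    impossible (inj₁ (S , t , v+…≡α)) = ℕ.<⇒≱ α<c₂ (begin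
      c₂                           ≤⟨ ℕ.m≤n*m c₂ (suc S) ⟩
      suc S * c₂                   ≤⟨ ℕ.m≤m+n _ _ ⟩
      suc S * c₂ + t * r₃₂         ≤⟨ ℕ.m≤n+m _ v ⟩
      v + (suc S * c₂ + t * r₃₂)   ≡⟨ v+…≡α ⟩
      α                            ∎)
      where open ℕ.≤-Reasoning
    impossible (inj₂ (inj₁ (T , s , w+…≡β))) = ℕ.<⇒≱ β<c₃ (begin
      c₃                           ≤⟨ ℕ.m≤n*m c₃ (suc T) ⟩
      suc T * c₃                   ≤⟨ ℕ.m≤m+n _ _ ⟩
      suc T * c₃ + s * r₂₃         ≤⟨ ℕ.m≤n+m _ w ⟩
      w + (suc T * c₃ + s * r₂₃)   ≡⟨ w+…≡β ⟩
      β                            ∎)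
      where open ℕ.≤-Reasoning
    impossible (inj₂ (inj₂ (S , T , v≡ , w≡))) with r₁₂ ≤? α
    ... | no r₁₂≰α = crossing {α} {β} {v} {w} {S} {T} {r₁₂} {r₃₂} {r₁₃} {r₂₃} (ℕ.≰⇒> r₁₂≰α) β<c₃ v≡ w≡
    ... | yes r₁₂≤α = crossing {β} {α} {w} {v} {T} {S} {r₁₃} {r₂₃} {r₁₂} {r₃₂}
                        (ℕ.≰⇒> (λ r₁₃≤β → ¬corner (r₁₂≤α , r₁₃≤β))) α<c₂ w≡ v≡

  box-corners : ∀ {α β} → InBox α β → ¬ InBox (suc α) β → ¬ InBox α (suc β) →
    (suc α ≡ r₁₂ × suc β ≡ c₃) ⊎ (suc α ≡ c₂ × suc β ≡ r₁₃)
  box-corners {α} {β} (α<c₂ , β<c₃ , ¬corner) ¬box₁ ¬box₂ with r₁₂ ≤? α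
  ... | yes r₁₂≤α = inj₂
    ( last-below α<c₂ (λ 1+α<c₂ → ¬box₁ (1+α<c₂ , β<c₃ , λ (_ , r₁₃≤β) → ℕ.<⇒≱ β<r₁₃ r₁₃≤β))
    , last-below β<r₁₃ (λ 1+β<r₁₃ → ¬box₂ (α<c₂ , ℕ.<-≤-trans 1+β<r₁₃ (ℕ.m≤m+n r₁₃ r₂₃) ,
                                             λ (_ , r₁₃≤1+β) → ℕ.<⇒≱ 1+β<r₁₃ r₁₃≤1+β)))
    where
    β<r₁₃ : β < r₁₃
    β<r₁₃ = ℕ.≰⇒> (λ r₁₃≤β → ¬corner (r₁₂≤α , r₁₃≤β))
  ... | no r₁₂≰α = inj₁
    ( last-below α<r₁₂ (λ 1+α<r₁₂ → ¬box₁ (ℕ.<-≤-trans 1+α<r₁₂ (ℕ.m≤m+n r₁₂ r₃₂) , β<c₃ ,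
                                             λ (r₁₂≤1+α , _) → ℕ.<⇒≱ 1+α<r₁₂ r₁₂≤1+α))
    , last-below β<c₃ (λ 1+β<c₃ → ¬box₂ (α<c₂ , 1+β<c₃ , λ (r₁₂≤α , _) → r₁₂≰α r₁₂≤α)))
    where
    α<r₁₂ : α < r₁₂
    α<r₁₂ = ℕ.≰⇒> r₁₂≰α

  gap-PF : Bézout (+ a) (+ b) → ∀ {α β} → InBox α β →
    (suc α * b + β * c) ∈₊⟨ a , b , c ⟩ → (α * b + suc β * c) ∈₊⟨ a , b , c ⟩ → IsPF3 a b c (gap a b c (suc α) (suc β))
  gap-PF bz {α} {β} box right∈ up∈ = PF-by-generators
    (λ x∈ → InBox⇒∉ bz box (Equivalence.to (gap-∈⇔ α β) x∈))
    (subst (_∈⟨ a , b , c ⟩) (sym (gap-+ᵃ a b c α β)) (0 , α , β , refl))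
    (subst (_∈⟨ a , b , c ⟩) (sym (gap-+ᵇ a b c α β)) (Equivalence.from (gap-∈⇔ (suc α) β) right∈))
    (subst (_∈⟨ a , b , c ⟩) (sym (gap-+ᶜ a b c α β)) (Equivalence.from (gap-∈⇔ α (suc β)) up∈))

  PF-corners : Bézout (+ a) (+ b) → ∀ {x} → IsPF3 a b c x → x ≡ gap a b c r₁₂ c₃ ⊎ x ≡ gap a b c c₂ r₁₃
  PF-corners bz {x} pf@(x∉ , _) = from-gap (gap-or-∈ x+a∈)
    where
    x+a∈ : (x ℤ.+ + a) ∈⟨ a , b , c ⟩
    x+a∈ = proj₁ (PF⇒generators-∈ pf)
    x+b∈ : (x ℤ.+ + b) ∈⟨ a , b , c ⟩
    x+b∈ = proj₁ (proj₂ (PF⇒generators-∈ pf))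
    x+c∈ : (x ℤ.+ + c) ∈⟨ a , b , c ⟩
    x+c∈ = proj₂ (proj₂ (PF⇒generators-∈ pf))
    from-gap : x ∈⟨ a , b , c ⟩ ⊎ ∃[ α ] ∃[ β ] x ≡ gap a b c (suc α) (suc β) →
      x ≡ gap a b c r₁₂ c₃ ⊎ x ≡ gap a b c c₂ r₁₃
    from-gap (inj₁ x∈) = ⊥-elim (x∉ x∈)
    from-gap (inj₂ (α , β , refl)) =
      to-corner (box-corners box (λ box₁ → InBox⇒∉ bz box₁ right∈) (λ box₂ → InBox⇒∉ bz box₂ up∈))
      where
      box : InBox α β
      box = ∉⇒InBox (λ m → x∉ (Equivalence.from (gap-∈⇔ α β) m))
      right∈ : (suc α * b + β * c) ∈₊⟨ a , b , c ⟩
      right∈ = Equivalence.to (gap-∈⇔ (suc α) β) (subst (_∈⟨ a , b , c ⟩) (gap-+ᵇ a b c α β) x+b∈)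
      up∈ : (α * b + suc β * c) ∈₊⟨ a , b , c ⟩
      up∈ = Equivalence.to (gap-∈⇔ α (suc β)) (subst (_∈⟨ a , b , c ⟩) (gap-+ᶜ a b c α β) x+c∈)
      to-corner : (suc α ≡ r₁₂ × suc β ≡ c₃) ⊎ (suc α ≡ c₂ × suc β ≡ r₁₃) →
        gap a b c (suc α) (suc β) ≡ gap a b c r₁₂ c₃ ⊎ gap a b c (suc α) (suc β) ≡ gap a b c c₂ r₁₃
      to-corner (inj₁ (α≡ , β≡)) = inj₁ (cong₂ (gap a b c) α≡ β≡)
      to-corner (inj₂ (α≡ , β≡)) = inj₂ (cong₂ (gap a b c) α≡ β≡)

  corners-PF : Bézout (+ a) (+ b) → ∀ {x} → x ≡ gap a b c r₁₂ c₃ ⊎ x ≡ gap a b c c₂ r₁₃ → IsPF3 a b c x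
  corners-PF bz (inj₁ refl) = subst (IsPF3 a b c) (cong₂ (gap a b c) (ℕ.suc-pred r₁₂) (ℕ.suc-pred c₃))
    (gap-PF bz (ℕ.<-≤-trans (pred< r₁₂) (ℕ.m≤m+n r₁₂ r₃₂) , pred< c₃ , λ (r₁₂≤ , _) → ℕ.<⇒≱ (pred< r₁₂) r₁₂≤)
      (in-corner (≤suc-pred r₁₂) (ℕ.<⇒≤pred (ℕ.m<m+n r₁₃ (ℕ.>-nonZero⁻¹ r₂₃))))
      (beyond-c₃ (pred r₁₂) (≤suc-pred c₃)))
  corners-PF bz (inj₂ refl) = subst (IsPF3 a b c) (cong₂ (gap a b c) (ℕ.suc-pred c₂) (ℕ.suc-pred r₁₃))
    (gap-PF bz (pred< c₂ , ℕ.<-≤-trans (pred< r₁₃) (ℕ.m≤m+n r₁₃ r₂₃) , λ (_ , r₁₃≤) → ℕ.<⇒≱ (pred< r₁₃) r₁₃≤)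
      (beyond-c₂ (pred r₁₃) (≤suc-pred c₂))
      (in-corner (ℕ.<⇒≤pred (ℕ.m<m+n r₁₂ (ℕ.>-nonZero⁻¹ r₃₂))) (≤suc-pred r₁₃)))

  PF≡corners : Bézout (+ a) (+ b) → PF≡gaps a b c r₁₂ c₃ c₂ r₁₃
  PF≡corners bz = pf≡gaps λ x → mk⇔ (PF-corners bz) (corners-PF bz)

module FibonacciSquares where

  open import Data.Nat using (_+_; _*_; _/_)
  open import Data.Nat.DivMod using (m*n/n≡m)
  open import Data.Nat.Divisibility using (divides; ∣m+n∣m⇒∣n; quotient; quotient≢0; m∣n⇒n≡m*quotient)
  open Coprimality using (bézout-sq; fib-bézout)
  open import Data.Nat.Tactic.RingSolver using (solve)
  open import Data.Integer using (+_)
  open import Function.Base using (_∋_)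
  open Syzygies using (Bézout)
  open Gaps using (PF≡gaps; PF≡gaps-cong)

  private
    instance
      sum-nonZero : ∀ {m n} → .{{NonZero m}} → NonZero (m + n)
      sum-nonZero {m} {n} = m+n≢0 m n

  halve : ∀ m k → m ≡ k * 2 → k ≡ m / 2
  halve _ k refl = sym (m*n/n≡m k 2)

  -- In each family y, x, f₂, f₃, … follows the Fibonacci recurrence: y = f_{n−3} in the first two
  -- (so f₃ = f_n) and y = f_{n−2} in the third (so f₂ = f_n).
  PF-family-fₙ-even : ∀ x y d → y ≡ 2 * d → .{{NonZero x}} → .{{NonZero d}} →
    let f₂ = x + y ; f₃ = f₂ + x ; f₄ = f₃ + f₂ ; f₅ = f₄ + f₃ ; f₆ = f₅ + f₄ in
    Bézout (+ sq f₃) (+ sq f₄) → PF≡gaps (sq f₃) (sq f₄) (sq f₅) f₄ (f₃ / 2) (f₆ / 2) x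
  PF-family-fₙ-even x _ d refl bz =
    let f₂ = x + 2 * d ; f₃ = f₂ + x ; f₄ = f₃ + f₂ ; f₅ = f₄ + f₃ ; f₆ = f₅ + f₄ in
    PF≡gaps-cong
      (Herzog.PF≡corners (f₃ * f₃) (f₄ * f₄) (f₅ * f₅) f₄ x (9 * x + 11 * d) d (4 * x + 5 * d) (x + d)
        (solve (x ∷ d ∷ [])) (solve (x ∷ d ∷ [])) (solve (x ∷ d ∷ [])) bz)
      refl (halve f₃ (x + d) (solve (x ∷ d ∷ []))) (halve f₆ (f₄ + (x + d)) (solve (x ∷ d ∷ []))) refl

  PF-family-fₙ₊₁-even : ∀ x y e → x ≡ 2 * e → .{{NonZero e}} →
    let f₂ = x + y ; f₃ = f₂ + x ; f₄ = f₃ + f₂ ; f₅ = f₄ + f₃ in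
    Bézout (+ sq f₃) (+ sq f₄) → PF≡gaps (sq f₃) (sq f₄) (sq f₅) (f₄ / 2) (f₄ / 2) f₅ (x / 2)
  PF-family-fₙ₊₁-even _ y e refl bz =
    let x = 2 * e ; f₂ = x + y ; f₃ = f₂ + x ; f₄ = f₃ + f₂ ; f₅ = f₄ + f₃ in
    PF≡gaps-cong
      (Herzog.PF≡corners (f₃ * f₃) (f₄ * f₄) (f₅ * f₅)
         (3 * e + y) e (10 * e + 3 * y) (2 * e + y) (3 * e + y) (7 * e + 2 * y)
        (solve (e ∷ y ∷ [])) (solve (e ∷ y ∷ [])) (solve (e ∷ y ∷ [])) bz)
      (halve f₄ (3 * e + y) (solve (e ∷ y ∷ []))) (halve f₄ (e + (2 * e + y)) (solve (e ∷ y ∷ [])))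
      ((3 * e + y + (7 * e + 2 * y) ≡ f₅) ∋ solve (e ∷ y ∷ [])) (halve x e (solve (e ∷ [])))

  PF-family-fₙ₊₂-even : ∀ x y g → x ≡ 2 * g → .{{NonZero g}} →
    let f₂ = x + y ; f₃ = f₂ + x ; f₄ = f₃ + f₂ in
    Bézout (+ sq f₂) (+ sq f₃) → PF≡gaps (sq f₂) (sq f₃) (sq f₄) (x / 2) f₂ (f₄ / 2) ((y + f₂) / 2)
  PF-family-fₙ₊₂-even _ y g refl bz =
    let x = 2 * g ; f₂ = x + y ; f₃ = f₂ + x ; f₄ = f₃ + f₂ in
    PF≡gaps-cong
      (Herzog.PF≡corners (f₂ * f₂) (f₃ * f₃) (f₄ * f₄) g (g + y) (3 * g + y) g (10 * g + 3 * y) (2 * g + y)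
        (solve (g ∷ y ∷ [])) (solve (g ∷ y ∷ [])) (solve (g ∷ y ∷ [])) bz)
      (halve x g (solve (g ∷ []))) ((g + y + g ≡ f₂) ∋ solve (g ∷ y ∷ []))
      (halve f₄ (g + (2 * g + y)) (solve (g ∷ y ∷ []))) (halve (y + f₂) (g + y) (solve (g ∷ y ∷ [])))

  fib-suc-nonZero : ∀ n → NonZero (fib (suc n))
  fib-suc-nonZero zero = _
  fib-suc-nonZero (suc n) = m+n≢0 (fib (suc n)) (fib n) {{fib-suc-nonZero n}}

  2∣fib[3+n]⇒2∣fib[n] : ∀ n → 2 ∣ fib (3 + n) → 2 ∣ fib n
  2∣fib[3+n]⇒2∣fib[n] n 2∣f = ∣m+n∣m⇒∣n (subst (2 ∣_) (regroup (fib (suc n)) (fib n)) 2∣f) (divides (fib (suc n)) refl)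
    where
    regroup : ∀ x y → x + y + x ≡ x * 2 + y
    regroup x y = solve (x ∷ y ∷ [])

  PF-S-2∣fₙ : ∀ n → 4 ≤ n → 2 ∣ fib n →
    PF≡gaps (sq (fib n)) (sq (fib (suc n))) (sq (fib (2 + n)))
            (fib (suc n)) (fib n / 2) (fib (3 + n) / 2) (fib (n ∸ 2))
  PF-S-2∣fₙ (suc (suc (suc (suc m)))) (s≤s (s≤s (s≤s (s≤s _)))) 2∣f =
    PF-family-fₙ-even (fib (2 + m)) (fib (suc m)) (quotient 2∣y) (m∣n⇒n≡m*quotient 2∣y)
      {{fib-suc-nonZero (suc m)}} {{quotient≢0 2∣y {{fib-suc-nonZero m}}}} (bézout-sq (fib-bézout (4 + m)))
    where
    2∣y : 2 ∣ fib (suc m)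
    2∣y = 2∣fib[3+n]⇒2∣fib[n] (suc m) 2∣f

  PF-S-2∣fₙ₊₁ : ∀ n → 4 ≤ n → 2 ∣ fib (suc n) →
    PF≡gaps (sq (fib n)) (sq (fib (suc n))) (sq (fib (2 + n)))
            (fib (suc n) / 2) (fib (suc n) / 2) (fib (2 + n)) (fib (n ∸ 2) / 2)
  PF-S-2∣fₙ₊₁ (suc (suc (suc k))) (s≤s (s≤s (s≤s _))) 2∣f =
    PF-family-fₙ₊₁-even (fib (suc k)) (fib k) (quotient 2∣x) (m∣n⇒n≡m*quotient 2∣x)
      {{quotient≢0 2∣x {{fib-suc-nonZero k}}}} (bézout-sq (fib-bézout (3 + k)))
    where
    2∣x : 2 ∣ fib (suc k)
    2∣x = 2∣fib[3+n]⇒2∣fib[n] (suc k) 2∣f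

  PF-S-2∣fₙ₊₂ : ∀ n → 4 ≤ n → 2 ∣ fib (2 + n) →
    PF≡gaps (sq (fib n)) (sq (fib (suc n))) (sq (fib (2 + n)))
            (fib (n ∸ 1) / 2) (fib n) (fib (2 + n) / 2) ((fib (n ∸ 2) + fib n) / 2)
  PF-S-2∣fₙ₊₂ (suc (suc p)) (s≤s (s≤s _)) 2∣f =
    PF-family-fₙ₊₂-even (fib (suc p)) (fib p) (quotient 2∣x) (m∣n⇒n≡m*quotient 2∣x)
      {{quotient≢0 2∣x {{fib-suc-nonZero p}}}} (bézout-sq (fib-bézout (2 + p)))
    where
    2∣x : 2 ∣ fib (suc p)
    2∣x = 2∣fib[3+n]⇒2∣fib[n] (suc p) 2∣f

open import Data.Integer using (ℤ; _+_; _-_; _*_; +_)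
open FibonacciSquares using (PF-S-2∣fₙ; PF-S-2∣fₙ₊₁; PF-S-2∣fₙ₊₂)
open Gaps.PF≡gaps using (characterisation)

theorem5p15 : (n : ℕ) → 4 ≤ n →
    ((2 ∣ fib n) → (x : ℤ) → PF-S n x ⇔
      ((x ≡ (F (n Data.Nat.+ 1) - + 1) * F² (n Data.Nat.+ 1) + (half (fib n) - + 1) * F² (n Data.Nat.+ 2) - F² n)
       ⊎ (x ≡ (half (fib (n Data.Nat.+ 3)) - + 1) * F² (n Data.Nat.+ 1) + (F (n ∸ 2) - + 1) * F² (n Data.Nat.+ 2) - F² n)))
    × ((2 ∣ fib (n Data.Nat.+ 1)) → (x : ℤ) → PF-S n x ⇔
      ((x ≡ (half (fib (n Data.Nat.+ 1)) - + 1) * F² (n Data.Nat.+ 1) + (half (fib (n Data.Nat.+ 1)) - + 1) * F² (n Data.Nat.+ 2) - F² n)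
       ⊎ (x ≡ (F (n Data.Nat.+ 2) - + 1) * F² (n Data.Nat.+ 1) + (half (fib (n ∸ 2)) - + 1) * F² (n Data.Nat.+ 2) - F² n)))
    × ((2 ∣ fib (n Data.Nat.+ 2)) → (x : ℤ) → PF-S n x ⇔
      ((x ≡ (half (fib (n ∸ 1)) - + 1) * F² (n Data.Nat.+ 1) + (F n - + 1) * F² (n Data.Nat.+ 2) - F² n)
       ⊎ (x ≡ (half (fib (n Data.Nat.+ 2)) - + 1) * F² (n Data.Nat.+ 1) + (half (fib (n ∸ 2) Data.Nat.+ fib n) - + 1) * F² (n Data.Nat.+ 2) - F² n)))
theorem5p15 n 4≤n rewrite +-comm n 1 | +-comm n 2 | +-comm n 3 =
  (λ 2∣fₙ → characterisation (PF-S-2∣fₙ n 4≤n 2∣fₙ)) ,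
  (λ 2∣fₙ₊₁ → characterisation (PF-S-2∣fₙ₊₁ n 4≤n 2∣fₙ₊₁)) ,
  (λ 2∣fₙ₊₂ → characterisation (PF-S-2∣fₙ₊₂ n 4≤n 2∣fₙ₊₂))
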